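{- Let $a_1,\dots,a_n$ be nonzero integers, $a_0$ a nonzero integer, $p=\sum_{i=1}^n a_ix_i+a_0$, and $\sigma_j=\sum_{i=1}^j a_i$. Suppose $\sigma_j\geq 0$ for all $j\le n$ and either $a_0\geq 0$ or $\sigma_n>1$. Let $m$ be any positive integer satisfying: $m\geq -\frac{a_0}{\sigma_n-1}$ if $\sigma_n>1$; $m\geq 0$ if $\sigma_n=1$ (and so $a_0\ge 0$); $m\le a_0$ if $\sigma_n=0$. Then the ordinary semigroup $\{0,m,\to\}=\{0\}\cup\{m,m+1,\dots\}$ admits $p$.
   Context: A numerical semigroup $\Lambda$ admits $p$ if $p(s_1,\dots,s_n)\in\Lambda$ for all nonzero $s_1\geq\cdots\geq s_n$ in $\Lambda$. -}

module Defs where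

open import Data.Nat as ℕ using (ℕ; zero; suc)
open import Data.Integer using (ℤ; +_; _+_; _*_; _≤_; 0ℤ)
open import Data.Fin as Fin using (Fin; inject≤)
open import Data.Sum using (_⊎_)
open import Relation.Binary.PropositionalEquality using (_≡_)
open import Relation.Nullary using (¬_)

sumFin : ∀ {n} → (Fin n → ℤ) → ℤ
sumFin {zero}  f = 0ℤ
sumFin {suc n} f = f Fin.zero + sumFin (λ i → f (Fin.suc i))

-- partial sum σ_j = a_1 + ... + a_j  (j ≤ n; Fin indices 0..n-1 stand for 1..n)
σ : ∀ {n} → (Fin n → ℤ) → (j : ℕ) → j ℕ.≤ n → ℤ
σ a j j≤n = sumFin (λ (i : Fin j) → a (inject≤ i j≤n))

evalLin : ∀ {n} → (Fin n → ℤ) → ℤ → (Fin n → ℤ) → ℤ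
evalLin a a₀ s = sumFin (λ i → a i * s i) + a₀

Ordinary : ℕ → ℤ → Set
Ordinary m x = x ≡ 0ℤ ⊎ + m ≤ x

Admits : (Λ : ℤ → Set) → ∀ {n} → (Fin n → ℤ) → ℤ → Set
Admits Λ {n} a a₀ =
  (s : Fin n → ℤ) →
  (∀ i → Λ (s i)) →
  (∀ i → ¬ (s i ≡ 0ℤ)) →
  (∀ i j → i Fin.≤ j → s j ≤ s i) →
  Λ (evalLin a a₀ s)

σₙ : ∀ {n} → (Fin n → ℤ) → ℤ
σₙ a = sumFin a

module Submission where

-- Let s₁ ≥ ⋯ ≥ sₙ be nonzero elements of {0, m, →}; all of them are
-- then ≥ m.  By Abel summation, nonnegative partial sums σⱼ together with a
-- nonincreasing sequence bounded below by t give  Σ aᵢ sᵢ ≥ σₙ · t.  With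
-- t = m this yields  p(s) ≥ σₙ m + a₀, and a case split on σₙ ∈ {0, 1, ≥ 2}
-- using the hypothesis on m turns this into  p(s) ≥ m, so p(s) ∈ {0, m, →}.

open import Defs
open import Data.Nat as ℕ using (ℕ; suc)
open import Data.Integer using (ℤ; +_; -_; _+_; _-_; _*_; _≤_; _<_; 0ℤ; 1ℤ; +<+; nonNegative)
open import Data.Integer.Properties
open import Data.Integer.Tactic.RingSolver using (solve-∀)
import Data.Nat.Properties as ℕP
open import Data.Fin as Fin using (Fin)
open import Data.Sum using (_⊎_; inj₁; inj₂)
open import Data.Empty using (⊥-elim)
open import Relation.Binary.PropositionalEquality using (_≡_; refl; sym; cong)
open import Relation.Nullary using (¬_)

Nonincreasing : ∀ {n} → (Fin n → ℤ) → Set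
Nonincreasing s = ∀ i j → i Fin.≤ j → s j ≤ s i

PrefixNonneg : ∀ {n} → ℤ → (Fin n → ℤ) → Set
PrefixNonneg {n} c a = (j : ℕ) (j≤n : j ℕ.≤ n) → 0ℤ ≤ c + σ a j j≤n

prefixNonneg-tail : ∀ {n} c (a : Fin (suc n) → ℤ) → PrefixNonneg c a →
  PrefixNonneg (c + a Fin.zero) (λ i → a (Fin.suc i))
prefixNonneg-tail c a pre j j≤n =
  ≤-trans (pre (suc j) (ℕ.s≤s j≤n)) (≤-reflexive (sym (+-assoc c (a Fin.zero) _)))

-- In the induction step, c u ≥ c s₁ and the weight c + a₁ is carried to s₁.
abel-carry : ∀ n (a s : Fin n → ℤ) (c t u : ℤ) → 0ℤ ≤ c → PrefixNonneg c a →
  Nonincreasing s → (∀ i → t ≤ s i) → (∀ i → s i ≤ u) → t ≤ u →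
  (c + σₙ a) * t ≤ c * u + sumFin (λ i → a i * s i)
abel-carry ℕ.zero a s c t u c≥0 _ _ _ _ t≤u = begin
  (c + 0ℤ) * t  ≡⟨ cong (_* t) (+-identityʳ c) ⟩
  c * t         ≤⟨ *-monoˡ-≤-nonNeg c {{nonNegative c≥0}} t≤u ⟩
  c * u         ≡⟨ sym (+-identityʳ (c * u)) ⟩
  c * u + 0ℤ    ∎
  where open ≤-Reasoning
abel-carry (suc n) a s c t u c≥0 pre mono t≤s s≤u _ = begin
  (c + (a₁ + σₙ a')) * t        ≡⟨ cong (_* t) (sym (+-assoc c a₁ (σₙ a'))) ⟩
  (c + a₁ + σₙ a') * t          ≤⟨ tail-bound ⟩
  (c + a₁) * s₁ + R             ≡⟨ distribute c a₁ s₁ R ⟩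
  c * s₁ + (a₁ * s₁ + R)        ≤⟨ +-monoˡ-≤ (a₁ * s₁ + R) (*-monoˡ-≤-nonNeg c {{nonNegative c≥0}} (s≤u Fin.zero)) ⟩
  c * u + (a₁ * s₁ + R)         ∎
  where
  open ≤-Reasoning
  a₁ = a Fin.zero
  s₁ = s Fin.zero
  a' s' : Fin n → ℤ
  a' i = a (Fin.suc i)
  s' i = s (Fin.suc i)
  R = sumFin (λ i → a' i * s' i)

  distribute : ∀ c a₁ s₁ R → (c + a₁) * s₁ + R ≡ c * s₁ + (a₁ * s₁ + R)
  distribute = solve-∀

  c+a₁≥0 : 0ℤ ≤ c + a₁
  c+a₁≥0 = ≤-trans (pre 1 (ℕ.s≤s ℕ.z≤n)) (≤-reflexive (cong (λ x → c + x) (+-identityʳ a₁)))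

  tail-bound : (c + a₁ + σₙ a') * t ≤ (c + a₁) * s₁ + R
  tail-bound = abel-carry n a' s' (c + a₁) t s₁ c+a₁≥0 (prefixNonneg-tail c a pre)
    (λ i j i≤j → mono (Fin.suc i) (Fin.suc j) (ℕ.s≤s i≤j))
    (λ i → t≤s (Fin.suc i)) (λ i → mono Fin.zero (Fin.suc i) ℕ.z≤n) (t≤s Fin.zero)

abel-bound : ∀ n (a s : Fin n → ℤ) (t : ℤ) → PrefixNonneg 0ℤ a →
  Nonincreasing s → (∀ i → t ≤ s i) → σₙ a * t ≤ sumFin (λ i → a i * s i)
abel-bound ℕ.zero a s t _ _ _ = ≤-reflexive (*-zeroˡ t)
abel-bound (suc n) a s t pre mono t≤s = begin
  σₙ a * t                             ≡⟨ cong (_* t) (sym (+-identityˡ (σₙ a))) ⟩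
  (0ℤ + σₙ a) * t                      ≤⟨ abel-carry (suc n) a s 0ℤ t (s Fin.zero) ≤-refl pre mono t≤s
                                            (λ i → mono Fin.zero i ℕ.z≤n) (t≤s Fin.zero) ⟩
  0ℤ * s Fin.zero + sumFin (λ i → a i * s i) ≡⟨ +-identityˡ _ ⟩
  sumFin (λ i → a i * s i)             ∎
  where open ≤-Reasoning

σ-full≡σₙ : ∀ n (a : Fin n → ℤ) → σ a n ℕP.≤-refl ≡ σₙ a
σ-full≡σₙ ℕ.zero a = refl
σ-full≡σₙ (suc n) a = cong (λ x → a Fin.zero + x) (σ-full≡σₙ n (λ i → a (Fin.suc i)))

-- From  σₙ m ≤ S  and the hypotheses on σₙ, a₀, m conclude  m ≤ S + a₀,
-- by cases σₙ = 0 (then m ≤ a₀), σₙ = 1 (then a₀ ≥ 0), σₙ ≥ 2 (then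
-- -a₀ ≤ m(σₙ - 1), i.e. m ≤ σₙ m + a₀).
shift-by-a₀ : (σv a₀ S : ℤ) (m : ℕ) → σv * + m ≤ S → 0ℤ ≤ σv →
  (0ℤ ≤ a₀ ⊎ 1ℤ < σv) → (1ℤ < σv → - a₀ ≤ + m * (σv - 1ℤ)) →
  (σv ≡ 0ℤ → + m ≤ a₀) → + m ≤ S + a₀
shift-by-a₀ (+ 0) a₀ S m σm≤S _ _ _ m≤a₀ = begin
  + m          ≡⟨ sym (+-identityˡ (+ m)) ⟩
  0ℤ + + m     ≤⟨ +-mono-≤ (≤-trans (≤-reflexive (sym (*-zeroˡ (+ m)))) σm≤S) (m≤a₀ refl) ⟩
  S + a₀       ∎
  where open ≤-Reasoning
shift-by-a₀ (+ 1) a₀ S m σm≤S _ (inj₁ a₀≥0) _ _ = begin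
  + m          ≡⟨ sym (+-identityʳ (+ m)) ⟩
  + m + 0ℤ     ≤⟨ +-mono-≤ (≤-trans (≤-reflexive (sym (*-identityˡ (+ m)))) σm≤S) a₀≥0 ⟩
  S + a₀       ∎
  where open ≤-Reasoning
shift-by-a₀ (+ 1) a₀ S m _ _ (inj₂ (+<+ (ℕ.s≤s ()))) _ _
shift-by-a₀ σv@(+ suc (suc _)) a₀ S m σm≤S _ _ bound _ = begin
  + m                             ≡⟨ split (+ m) σv ⟩
  σv * + m - + m * (σv - 1ℤ)      ≤⟨ +-monoʳ-≤ (σv * + m) (neg-mono-≤ (bound (+<+ (ℕ.s≤s (ℕ.s≤s ℕ.z≤n))))) ⟩
  σv * + m - - a₀                 ≡⟨ double-neg (σv * + m) a₀ ⟩
  σv * + m + a₀                   ≤⟨ +-monoˡ-≤ a₀ σm≤S ⟩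
  S + a₀                          ∎
  where
  open ≤-Reasoning
  split : ∀ m σv → m ≡ σv * m - m * (σv - 1ℤ)
  split = solve-∀
  double-neg : ∀ x a₀ → x - - a₀ ≡ x + a₀
  double-neg = solve-∀

ordinary-nonzero : ∀ {m x} → Ordinary m x → ¬ (x ≡ 0ℤ) → + m ≤ x
ordinary-nonzero (inj₁ x≡0) x≢0 = ⊥-elim (x≢0 x≡0)
ordinary-nonzero (inj₂ m≤x) _   = m≤x

mainTheorem10 : (n : ℕ) (a : Fin n → ℤ) (a₀ : ℤ) →
    (∀ i → ¬ (a i ≡ 0ℤ)) → ¬ (a₀ ≡ 0ℤ) →
    ((j : ℕ) (j≤n : j ℕ.≤ n) → 0ℤ ≤ σ a j j≤n) →
    (0ℤ ≤ a₀ ⊎ 1ℤ < σₙ a) →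
    (m : ℕ) → 0 ℕ.< m →
    (1ℤ < σₙ a → - a₀ ≤ + m * (σₙ a - 1ℤ)) →
    (σₙ a ≡ 0ℤ → + m ≤ a₀) →
    Admits (Ordinary m) a a₀
mainTheorem10 n a a₀ _ _ σⱼ≥0 a₀-or-σ m _ bound-σ>1 bound-σ≡0 s s∈Λ s≢0 mono =
  inj₂ (shift-by-a₀ (σₙ a) a₀ (sumFin (λ i → a i * s i)) m σm≤Σ σₙ≥0 a₀-or-σ bound-σ>1 bound-σ≡0)
  where
  pre : PrefixNonneg 0ℤ a
  pre j j≤n = ≤-trans (σⱼ≥0 j j≤n) (≤-reflexive (sym (+-identityˡ _)))

  σₙ≥0 : 0ℤ ≤ σₙ a
  σₙ≥0 = ≤-trans (σⱼ≥0 n ℕP.≤-refl) (≤-reflexive (σ-full≡σₙ n a))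

  σm≤Σ : σₙ a * + m ≤ sumFin (λ i → a i * s i)
  σm≤Σ = abel-bound n a s (+ m) pre mono (λ i → ordinary-nonzero (s∈Λ i) (s≢0 i))
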